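{- If $G$ is a GP$4$-graph, then $\gamma_{pr2}(G)=\frac{2}{5}|V(G)|$.
   Context: All graphs are finite and simple. A graph $G=(V,E)$ is a GP$4$-graph if it is obtained from a connected graph $H=(V_H,E_H)$ with $V_H=\{v_1,\dots,v_{n_H}\}$ by attaching a path to every vertex: $V=V_H\cup\{w_i,x_i,y_i,z_i : i\in[n_H]\}$ (new distinct vertices) and $E=E_H\cup\{v_iw_i,\,w_ix_i,\,x_iy_i,\,y_iz_i : i\in[n_H]\}$. For a graph $G$ with no isolated vertices, a semipaired dominating set is a set $D\subseteq V(G)$ such that every vertex outside $D$ has a neighbor in $D$ and $D$ can be partitioned into $2$-element subsets $\{u,v\}$ with the distance between $u$ and $v$ in $G$ at most $2$; $\gamma_{pr2}(G)$ denotes the minimum cardinality of a semipaired dominating set of $G$. -}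

module Defs where

open import Data.Nat using (ℕ; zero; suc; _*_)
open import Data.Fin using (Fin; zero; suc; remQuot)
open import Data.Fin.Subset using (Subset; _∈_; ∣_∣)
open import Data.Product using (Σ; ∃; _×_; _,_; proj₁; proj₂)
open import Data.Sum using (_⊎_)
open import Data.Empty using (⊥)
open import Data.Unit using (⊤; tt)
open import Data.List using (List; []; _∷_)
open import Data.List.Relation.Unary.Unique.Propositional using (Unique)
import Data.List.Membership.Propositional as L
open import Relation.Binary.PropositionalEquality using (_≡_; refl)
import Relation.Binary.PropositionalEquality as Eq
open import Relation.Nullary using (¬_)

record Graph : Set₁ where
  field
    n     : ℕ
    Adj   : Fin n → Fin n → Set
    sym   : ∀ {u v} → Adj u v → Adj v u
    irrefl : ∀ {u} → ¬ Adj u u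
open Graph public

data Reach (G : Graph) : Fin (n G) → Fin (n G) → Set where
  here : ∀ {u} → Reach G u u
  step : ∀ {u v w} → Adj G u v → Reach G v w → Reach G u w

Connected : Graph → Set
Connected G = ∀ u v → Reach G u v

-- Attaching the path v_i w_i x_i y_i z_i: vertex (i , k) with k = 0,1,2,3,4
-- stands for v_i, w_i, x_i, y_i, z_i respectively.
-- Adjacency on the labels 0..4 of a pendant path (|k - l| = 1)
PathAdj : Fin 5 → Fin 5 → Set
PathAdj zero (suc zero) = ⊤
PathAdj (suc zero) zero = ⊤
PathAdj (suc zero) (suc (suc zero)) = ⊤
PathAdj (suc (suc zero)) (suc zero) = ⊤
PathAdj (suc (suc zero)) (suc (suc (suc zero))) = ⊤
PathAdj (suc (suc (suc zero))) (suc (suc zero)) = ⊤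
PathAdj (suc (suc (suc zero))) (suc (suc (suc (suc zero)))) = ⊤
PathAdj (suc (suc (suc (suc zero)))) (suc (suc (suc zero))) = ⊤
PathAdj _ _ = ⊥

GP4Adj' : (H : Graph) → Fin (n H) × Fin 5 → Fin (n H) × Fin 5 → Set
GP4Adj' H (i , zero) (j , zero) = Adj H i j
GP4Adj' H (i , k) (j , l) = (i ≡ j) × PathAdj k l

GP4Adj : (H : Graph) → Fin (n H * 5) → Fin (n H * 5) → Set
GP4Adj H a b = GP4Adj' H (remQuot 5 a) (remQuot 5 b)

PathAdj-sym : ∀ {k l} → PathAdj k l → PathAdj l k
PathAdj-sym {zero} {suc zero} p = tt
PathAdj-sym {suc zero} {zero} p = tt
PathAdj-sym {suc zero} {suc (suc zero)} p = tt
PathAdj-sym {suc (suc zero)} {suc zero} p = tt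
PathAdj-sym {suc (suc zero)} {suc (suc (suc zero))} p = tt
PathAdj-sym {suc (suc (suc zero))} {suc (suc zero)} p = tt
PathAdj-sym {suc (suc (suc zero))} {suc (suc (suc (suc zero)))} p = tt
PathAdj-sym {suc (suc (suc (suc zero)))} {suc (suc (suc zero))} p = tt

PathAdj-irr : ∀ {k} → ¬ PathAdj k k
PathAdj-irr {zero} ()
PathAdj-irr {suc zero} ()
PathAdj-irr {suc (suc zero)} ()
PathAdj-irr {suc (suc (suc zero))} ()
PathAdj-irr {suc (suc (suc (suc zero)))} ()

GP4Adj'-sym : ∀ H {a b} → GP4Adj' H a b → GP4Adj' H b a
GP4Adj'-sym H {i , zero} {j , zero} p = sym H p
GP4Adj'-sym H {i , zero} {j , suc l} (e , p) = Eq.sym e , PathAdj-sym p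
GP4Adj'-sym H {i , suc k} {j , zero} (e , p) = Eq.sym e , PathAdj-sym p
GP4Adj'-sym H {i , suc k} {j , suc l} (e , p) = Eq.sym e , PathAdj-sym p

GP4Adj'-irr : ∀ H {a} → ¬ GP4Adj' H a a
GP4Adj'-irr H {i , zero} p = irrefl H p
GP4Adj'-irr H {i , suc k} (_ , p) = PathAdj-irr p

GP4 : Graph → Graph
GP4 H = record
  { n = n H * 5
  ; Adj = GP4Adj H
  ; sym = λ {a} {b} → GP4Adj'-sym H {remQuot 5 a} {remQuot 5 b}
  ; irrefl = λ {a} → GP4Adj'-irr H {remQuot 5 a}
  }

Dist≤2 : (G : Graph) → Fin (n G) → Fin (n G) → Set
Dist≤2 G u v = Adj G u v ⊎ ∃ λ w → Adj G u w × Adj G w v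

flatten : ∀ {A : Set} → List (A × A) → List A
flatten [] = []
flatten ((a , b) ∷ ps) = a ∷ b ∷ flatten ps

Dominating : (G : Graph) → Subset (n G) → Set
Dominating G D = ∀ v → ¬ (v ∈ D) → ∃ λ u → u ∈ D × Adj G v u

-- D is a semipaired dominating set: dominating, and D is partitioned into
-- 2-element subsets {u,v} (the pairs in ps, all listed vertices distinct)
-- with d(u,v) ≤ 2.
record SemipairedDom (G : Graph) (D : Subset (n G)) : Set where
  field
    dominating : Dominating G D
    pairs      : List (Fin (n G) × Fin (n G))
    distinct   : Unique (flatten pairs)
    covers     : ∀ v → v ∈ D → v L.∈ flatten pairs
    inside     : ∀ v → v L.∈ flatten pairs → v ∈ D
    close      : ∀ {u v} → (u , v) L.∈ pairs → Dist≤2 G u v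

IsγPr2 : (G : Graph) → ℕ → Set
IsγPr2 G k = (Σ (Subset (n G)) λ D → SemipairedDom G D × ∣ D ∣ ≡ k)
           × (∀ D → SemipairedDom G D → k Data.Nat.≤ ∣ D ∣)

module Submission where

-- Vertex v_i, w_i, x_i, y_i, z_i of G is the vertex
-- combine i k of Fin (n * 5) with label k = 0,1,2,3,4, so a subset of V(G)
-- is a vector of n blocks of length 5, the i-th block being the path at v_i.
--
-- Lower bound: every semipaired dominating set D meets each pendant path
-- w_i x_i y_i z_i in at least two vertices.  Indeed z_i must be dominated,
-- so y_i or z_i lies in D; x_i must be dominated, so one of w_i, x_i, y_i
-- lies in D; and if y_i is the only vertex of the path in D, then its
-- partner in D (at distance at most 2 from y_i) would have to be one of
-- w_i, x_i, z_i.  Summing over the n blocks gives |D| ≥ 2n.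
--
-- Upper bound: D = {w_i, y_i : i} with the pairs {w_i, y_i} (joined through
-- x_i) is a semipaired dominating set of size 2n.

open import Defs hiding (sym)
open import Data.Nat using (ℕ; zero; suc; _+_; _*_; _≤_; z≤n; s≤s)
open import Data.Nat.Properties using (+-mono-≤; ≤-trans; ≤-reflexive; *-comm; *-assoc)
open import Data.Fin using (Fin; zero; suc; combine)
open import Data.Fin.Properties using (remQuot-combine; combine-surjective; combine-injective)
open import Data.Fin.Subset using (Subset; _∈_; _∉_; ∣_∣; inside; outside)
open import Data.Fin.Subset.Properties using (∣p∣≤∣x∷p∣)
open import Data.Vec using (Vec; []; _∷_; _++_; lookup; tabulate; concat; replicate; group)
open import Data.Vec.Properties
  using (lookup⇒[]=; []=⇒lookup; lookup-concat; lookup-replicate; tabulate-cong; tabulate∘lookup)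
open import Data.Product using (Σ; ∃; _×_; _,_; proj₁; proj₂; <_,_>)
open import Data.Sum using (_⊎_; inj₁; inj₂)
open import Data.Empty using (⊥; ⊥-elim)
open import Data.Unit using (tt)
open import Data.List using (List; []; _∷_; map; allFin)
open import Data.List.Relation.Unary.Unique.Propositional using (Unique)
open import Data.List.Relation.Unary.Unique.Propositional.Properties using (allFin⁺)
open import Data.List.Relation.Unary.AllPairs using ([]; _∷_)
import Data.List.Relation.Unary.All as All
open import Data.List.Relation.Unary.Any using (here; there)
import Data.List.Membership.Propositional as List
open import Data.List.Membership.Propositional.Properties using (∈-map⁻; ∈-allFin)
open import Relation.Binary.PropositionalEquality
  using (_≡_; _≢_; refl; sym; trans; cong; subst; subst₂; module ≡-Reasoning)

block : ∀ {m k} → Subset (m * k) → Fin m → Subset k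
block D i = tabulate (λ j → lookup D (combine i j))

∣++∣ : ∀ {a b} (p : Subset a) (q : Subset b) → ∣ p ++ q ∣ ≡ ∣ p ∣ + ∣ q ∣
∣++∣ []            q = refl
∣++∣ (outside ∷ p) q = ∣++∣ p q
∣++∣ (inside ∷ p)  q = cong suc (∣++∣ p q)

block-concat : ∀ {m k} (xss : Vec (Subset k) m) i → block (concat xss) i ≡ lookup xss i
block-concat xss i = trans (tabulate-cong (lookup-concat xss i)) (tabulate∘lookup (lookup xss i))

blockwise-lower-bound : ∀ {m k} c (D : Subset (m * k)) →
  (∀ i → c ≤ ∣ block D i ∣) → m * c ≤ ∣ D ∣
blockwise-lower-bound {m} {k} c D large with group m k D
... | xss , refl = concat-bound xss (λ i → subst (c ≤_) (cong ∣_∣ (block-concat xss i)) (large i))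
  where
  concat-bound : ∀ {m} (xss : Vec (Subset k) m) →
    (∀ i → c ≤ ∣ lookup xss i ∣) → m * c ≤ ∣ concat xss ∣
  concat-bound []         _     = z≤n
  concat-bound (xs ∷ xss) large =
    ≤-trans (+-mono-≤ (large zero) (concat-bound xss (λ i → large (suc i))))
            (≤-reflexive (sym (∣++∣ xs (concat xss))))

repeat : ∀ m {k} → Subset k → Subset (m * k)
repeat m p = concat (replicate m p)

lookup-repeat : ∀ {m k} (p : Subset k) i j → lookup (repeat m p) (combine i j) ≡ lookup p j
lookup-repeat {m} p i j =
  trans (lookup-concat (replicate m p) i j) (cong (λ q → lookup q j) (lookup-replicate i p))

∣repeat∣ : ∀ m {k} (p : Subset k) → ∣ repeat m p ∣ ≡ m * ∣ p ∣
∣repeat∣ zero    p = refl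
∣repeat∣ (suc m) p = trans (∣++∣ p (repeat m p)) (cong (∣ p ∣ +_) (∣repeat∣ m p))

partner : ∀ {A : Set} (ps : List (A × A)) {a} → Unique (flatten ps) → a List.∈ flatten ps →
  ∃ λ b → a ≢ b × b List.∈ flatten ps × ((a , b) List.∈ ps ⊎ (b , a) List.∈ ps)
partner ((a , b) ∷ ps) (a∉ ∷ _) (here refl) =
  b , All.head a∉ , there (here refl) , inj₁ (here refl)
partner ((a , b) ∷ ps) (a∉ ∷ _) (there (here refl)) =
  a , (λ e → All.head a∉ (sym e)) , here refl , inj₂ (here refl)
partner ((a , b) ∷ ps) (_ ∷ _ ∷ distinct) (there (there a∈))
  with partner ps distinct a∈
... | c , a≢c , c∈ , inj₁ p = c , a≢c , there (there c∈) , inj₁ (there p)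
... | c , a≢c , c∈ , inj₂ p = c , a≢c , there (there c∈) , inj₂ (there p)

module PairList {A B : Set} (g h : A → B) where

  pairs : List A → List (B × B)
  pairs = map < g , h >

  ∈-pairs⁻ : ∀ xs {b} → b List.∈ flatten (pairs xs) → ∃ λ a → a List.∈ xs × (b ≡ g a ⊎ b ≡ h a)
  ∈-pairs⁻ (a ∷ xs) (here refl)         = a , here refl , inj₁ refl
  ∈-pairs⁻ (a ∷ xs) (there (here refl)) = a , here refl , inj₂ refl
  ∈-pairs⁻ (a ∷ xs) (there (there b∈)) with ∈-pairs⁻ xs b∈
  ... | a′ , a′∈ , eq = a′ , there a′∈ , eq

  ∈-pairs⁺ˡ : ∀ xs {a} → a List.∈ xs → g a List.∈ flatten (pairs xs)
  ∈-pairs⁺ˡ (_ ∷ xs) (here refl) = here refl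
  ∈-pairs⁺ˡ (_ ∷ xs) (there a∈)  = there (there (∈-pairs⁺ˡ xs a∈))

  ∈-pairs⁺ʳ : ∀ xs {a} → a List.∈ xs → h a List.∈ flatten (pairs xs)
  ∈-pairs⁺ʳ (_ ∷ xs) (here refl) = there (here refl)
  ∈-pairs⁺ʳ (_ ∷ xs) (there a∈)  = there (there (∈-pairs⁺ʳ xs a∈))

  unique-pairs : (∀ {a a′} → g a ≡ g a′ → a ≡ a′) → (∀ {a a′} → h a ≡ h a′ → a ≡ a′) →
    (∀ {a a′} → g a ≢ h a′) → ∀ xs → Unique xs → Unique (flatten (pairs xs))
  unique-pairs g-inj h-inj g≢h []       []           = []
  unique-pairs g-inj h-inj g≢h (a ∷ xs) (a∉ ∷ uniq) =
    (g≢h All.∷ All.tabulate g-fresh) ∷ (All.tabulate h-fresh ∷ unique-pairs g-inj h-inj g≢h xs uniq)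
    where
    g-fresh : ∀ {b} → b List.∈ flatten (pairs xs) → g a ≢ b
    g-fresh b∈ e with ∈-pairs⁻ xs b∈
    ... | a′ , a′∈ , inj₁ refl = All.lookup a∉ a′∈ (g-inj e)
    ... | a′ , a′∈ , inj₂ refl = g≢h e
    h-fresh : ∀ {b} → b List.∈ flatten (pairs xs) → h a ≢ b
    h-fresh b∈ e with ∈-pairs⁻ xs b∈
    ... | a′ , a′∈ , inj₁ refl = g≢h (sym e)
    ... | a′ , a′∈ , inj₂ refl = All.lookup a∉ a′∈ (h-inj e)

Dist≤2-sym : ∀ (G : Graph) {u v} → Dist≤2 G u v → Dist≤2 G v u
Dist≤2-sym G {u} {v} (inj₁ uv)           = inj₁ (Graph.sym G {u} {v} uv)
Dist≤2-sym G {u} {v} (inj₂ (w , uw , wv)) = inj₂ (w , Graph.sym G {w} {v} wv , Graph.sym G {u} {w} uw)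

semipaired-partner : ∀ {G D} → SemipairedDom G D → ∀ {u} → u ∈ D →
  ∃ λ v → u ≢ v × v ∈ D × Dist≤2 G u v
semipaired-partner {G} {D} S {u} u∈D = partner-in-D (partner pairs distinct (covers u u∈D))
  where
  open SemipairedDom S renaming (inside to listed⇒in-D)
  partner-in-D : (∃ λ v → u ≢ v × v List.∈ flatten pairs × ((u , v) List.∈ pairs ⊎ (v , u) List.∈ pairs)) →
    ∃ λ v → u ≢ v × v ∈ D × Dist≤2 G u v
  partner-in-D (v , u≢v , v∈ , inj₁ uv) = v , u≢v , listed⇒in-D v v∈ , close uv
  partner-in-D (v , u≢v , v∈ , inj₂ vu) = v , u≢v , listed⇒in-D v v∈ , Dist≤2-sym G (close vu)

pattern V = zero
pattern W = suc zero
pattern X = suc (suc zero)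
pattern Y = suc (suc (suc zero))
pattern Z = suc (suc (suc (suc zero)))

path-neighbour-X : ∀ l → PathAdj X l → l ≡ W ⊎ l ≡ Y
path-neighbour-X W _ = inj₁ refl
path-neighbour-X Y _ = inj₂ refl

path-neighbour-Y : ∀ l → PathAdj Y l → l ≡ X ⊎ l ≡ Z
path-neighbour-Y X _ = inj₁ refl
path-neighbour-Y Z _ = inj₂ refl

path-neighbour-Z : ∀ l → PathAdj Z l → l ≡ Y
path-neighbour-Z Y _ = refl

module GP4-paths (H : Graph) where

  G : Graph
  G = GP4 H

  vertex : Fin (n H) → Fin 5 → Fin (n G)
  vertex i k = combine i k

  vertex-injective : ∀ {i k j l} → vertex i k ≡ vertex j l → i ≡ j × k ≡ l
  vertex-injective {i} {k} {j} {l} = combine-injective i k j l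

  adjacent⁺ : ∀ {i k j l} → GP4Adj' H (i , k) (j , l) → Adj G (vertex i k) (vertex j l)
  adjacent⁺ {i} {k} {j} {l} =
    subst₂ (GP4Adj' H) (sym (remQuot-combine {n H} {5} i k)) (sym (remQuot-combine {n H} {5} j l))

  adjacent⁻ : ∀ {i k j l} → Adj G (vertex i k) (vertex j l) → GP4Adj' H (i , k) (j , l)
  adjacent⁻ {i} {k} {j} {l} =
    subst₂ (GP4Adj' H) (remQuot-combine {n H} {5} i k) (remQuot-combine {n H} {5} j l)

  path-neighbour : ∀ {i} {k : Fin 4} u → Adj G (vertex i (suc k)) u →
    ∃ λ l → u ≡ vertex i l × PathAdj (suc k) l
  path-neighbour {i} {k} u adj with combine-surjective {n H} {5} u
  ... | j , l , refl with adjacent⁻ {i} {suc k} {j} {l} adj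
  ... | refl , pathAdj = l , refl , pathAdj

  neighbour-X : ∀ {i} u → Adj G (vertex i X) u → u ≡ vertex i W ⊎ u ≡ vertex i Y
  neighbour-X u adj with path-neighbour u adj
  ... | l , refl , pathAdj with path-neighbour-X l pathAdj
  ... | inj₁ refl = inj₁ refl
  ... | inj₂ refl = inj₂ refl

  neighbour-Y : ∀ {i} u → Adj G (vertex i Y) u → u ≡ vertex i X ⊎ u ≡ vertex i Z
  neighbour-Y u adj with path-neighbour u adj
  ... | l , refl , pathAdj with path-neighbour-Y l pathAdj
  ... | inj₁ refl = inj₁ refl
  ... | inj₂ refl = inj₂ refl

  neighbour-Z : ∀ {i} u → Adj G (vertex i Z) u → u ≡ vertex i Y
  neighbour-Z u adj with path-neighbour u adj
  ... | l , refl , pathAdj with path-neighbour-Z l pathAdj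
  ... | refl = refl

  near-Y : ∀ {i} u → Dist≤2 G (vertex i Y) u → vertex i Y ≢ u →
    u ≡ vertex i W ⊎ u ≡ vertex i X ⊎ u ≡ vertex i Z
  near-Y u (inj₁ adj) _ with neighbour-Y u adj
  ... | inj₁ refl = inj₂ (inj₁ refl)
  ... | inj₂ refl = inj₂ (inj₂ refl)
  near-Y u (inj₂ (w , adj₁ , adj₂)) y≢u with neighbour-Y w adj₁
  ... | inj₁ refl with neighbour-X u adj₂
  ...   | inj₁ refl = inj₁ refl
  ...   | inj₂ refl = ⊥-elim (y≢u refl)
  near-Y u (inj₂ (w , adj₁ , adj₂)) y≢u | inj₂ refl with neighbour-Z u adj₂
  ...   | refl = ⊥-elim (y≢u refl)

-- Lower bound: a semipaired dominating set meets every pendant path twice.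

module LowerBound (H : Graph) (D : Subset (n (GP4 H))) (S : SemipairedDom (GP4 H) D) where
  open GP4-paths H
  open SemipairedDom S using (dominating)

  z-dominated : ∀ i → vertex i Y ∉ D → vertex i Z ∉ D → ⊥
  z-dominated i y∉ z∉ with dominating (vertex i Z) z∉
  ... | u , u∈ , adj with neighbour-Z u adj
  ... | refl = y∉ u∈

  x-dominated : ∀ i → vertex i W ∉ D → vertex i X ∉ D → vertex i Y ∉ D → ⊥
  x-dominated i w∉ x∉ y∉ with dominating (vertex i X) x∉
  ... | u , u∈ , adj with neighbour-X u adj
  ... | inj₁ refl = w∉ u∈
  ... | inj₂ refl = y∉ u∈

  y-partnered : ∀ i → vertex i Y ∈ D → vertex i W ∉ D → vertex i X ∉ D → vertex i Z ∉ D → ⊥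
  y-partnered i y∈ w∉ x∉ z∉ with semipaired-partner S y∈
  ... | u , y≢u , u∈ , near with near-Y u near y≢u
  ... | inj₁ refl        = w∉ u∈
  ... | inj₂ (inj₁ refl) = x∉ u∈
  ... | inj₂ (inj₂ refl) = z∉ u∈

  member : ∀ {v} → lookup D v ≡ inside → v ∈ D
  member {v} = lookup⇒[]= v D

  nonmember : ∀ {v} → lookup D v ≡ outside → v ∉ D
  nonmember out v∈ with trans (sym ([]=⇒lookup v∈)) out
  ... | ()

  path-part : Fin (n H) → Subset 4
  path-part i = tabulate (λ k → lookup D (vertex i (suc k)))

  two-on-path : ∀ i → 2 ≤ ∣ path-part i ∣
  two-on-path i
    with lookup D (vertex i W) in w | lookup D (vertex i X) in x
       | lookup D (vertex i Y) in y | lookup D (vertex i Z) in z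
  ... | inside  | inside  | _       | _       = s≤s (s≤s z≤n)
  ... | inside  | outside | inside  | _       = s≤s (s≤s z≤n)
  ... | inside  | outside | outside | inside  = s≤s (s≤s z≤n)
  ... | outside | inside  | inside  | _       = s≤s (s≤s z≤n)
  ... | outside | inside  | outside | inside  = s≤s (s≤s z≤n)
  ... | outside | outside | inside  | inside  = s≤s (s≤s z≤n)
  ... | _       | _       | outside | outside = ⊥-elim (z-dominated i (nonmember y) (nonmember z))
  ... | outside | outside | outside | inside  = ⊥-elim (x-dominated i (nonmember w) (nonmember x) (nonmember y))
  ... | outside | outside | inside  | outside = ⊥-elim (y-partnered i (member y) (nonmember w) (nonmember x) (nonmember z))

  -- Adding the root v_i only increases the count.
  two-per-block : ∀ i → 2 ≤ ∣ block D i ∣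
  two-per-block i = ≤-trans (two-on-path i) (∣p∣≤∣x∷p∣ (lookup D (vertex i V)) (path-part i))

  lower-bound : n H * 2 ≤ ∣ D ∣
  lower-bound = blockwise-lower-bound 2 D two-per-block

-- Upper bound: the vertices w_i and y_i, paired as {w_i, y_i}.

module UpperBound (H : Graph) where
  open GP4-paths H
  open PairList (λ i → vertex i W) (λ i → vertex i Y)

  chosen-on-path : Subset 5
  chosen-on-path = outside ∷ inside ∷ outside ∷ inside ∷ outside ∷ []

  D : Subset (n G)
  D = repeat (n H) chosen-on-path

  chosen : ∀ i k → lookup chosen-on-path k ≡ inside → vertex i k ∈ D
  chosen i k c = lookup⇒[]= (vertex i k) D (trans (lookup-repeat chosen-on-path i k) c)

  dominating : Dominating G D
  dominating u u∉ with combine-surjective {n H} {5} u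
  ... | i , V , refl = vertex i W , chosen i W refl , adjacent⁺ (refl , tt)
  ... | i , W , refl = ⊥-elim (u∉ (chosen i W refl))
  ... | i , X , refl = vertex i W , chosen i W refl , adjacent⁺ (refl , tt)
  ... | i , Y , refl = ⊥-elim (u∉ (chosen i Y refl))
  ... | i , Z , refl = vertex i Y , chosen i Y refl , adjacent⁺ (refl , tt)

  chosen⇒listed : ∀ u → u ∈ D → u List.∈ flatten (pairs (allFin (n H)))
  chosen⇒listed u u∈ with combine-surjective {n H} {5} u
  ... | i , k , refl = on-path k (trans (sym (lookup-repeat chosen-on-path i k)) ([]=⇒lookup u∈))
    where
    on-path : ∀ k → lookup chosen-on-path k ≡ inside → vertex i k List.∈ flatten (pairs (allFin (n H)))
    on-path W _ = ∈-pairs⁺ˡ (allFin (n H)) (∈-allFin i)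
    on-path Y _ = ∈-pairs⁺ʳ (allFin (n H)) (∈-allFin i)
    on-path V ()
    on-path X ()
    on-path Z ()

  listed⇒chosen : ∀ u → u List.∈ flatten (pairs (allFin (n H))) → u ∈ D
  listed⇒chosen u u∈ with ∈-pairs⁻ (allFin (n H)) u∈
  ... | i , _ , inj₁ refl = chosen i W refl
  ... | i , _ , inj₂ refl = chosen i Y refl

  close : ∀ {u v} → (u , v) List.∈ pairs (allFin (n H)) → Dist≤2 G u v
  close uv with ∈-map⁻ _ uv
  ... | i , _ , refl = inj₂ (vertex i X , adjacent⁺ (refl , tt) , adjacent⁺ (refl , tt))

  distinct : Unique (flatten (pairs (allFin (n H))))
  distinct = unique-pairs (λ e → proj₁ (vertex-injective e))
                          (λ e → proj₁ (vertex-injective e))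
                          (λ e → W≢Y (proj₂ (vertex-injective e)))
                          (allFin (n H)) (allFin⁺ (n H))
    where
    W≢Y : W ≢ Y
    W≢Y ()

  semipaired : SemipairedDom G D
  semipaired = record
    { dominating = dominating ; pairs = pairs (allFin (n H)) ; distinct = distinct
    ; covers = chosen⇒listed ; inside = listed⇒chosen ; close = close }

  size : ∣ D ∣ ≡ n H * 2
  size = ∣repeat∣ (n H) chosen-on-path

-- γ_pr2(GP4(H)) = 2 |V(H)| = (2/5) |V(GP4(H))|.
theorem1 : (H : Graph) → Connected H →
    Σ ℕ (λ γ → IsγPr2 (GP4 H) γ × 5 * γ ≡ 2 * n (GP4 H))
theorem1 H _ =
  n H * 2 ,
  ((UpperBound.D H , UpperBound.semipaired H , UpperBound.size H) ,
   (λ D S → LowerBound.lower-bound H D S)) ,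
  five-fifths
  where
  open ≡-Reasoning
  five-fifths : 5 * (n H * 2) ≡ 2 * (n H * 5)
  five-fifths = begin
    5 * (n H * 2) ≡⟨ *-comm 5 (n H * 2) ⟩
    n H * 2 * 5   ≡⟨ *-assoc (n H) 2 5 ⟩
    n H * 10      ≡⟨ sym (*-assoc (n H) 5 2) ⟩
    n H * 5 * 2   ≡⟨ *-comm (n H * 5) 2 ⟩
    2 * (n H * 5) ∎
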